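{- Every $3$-degenerate claw-free graph $G$ with maximum degree $\Delta\geq 4$ is equitable list point $k$-arborable for every integer $k\geq \lceil (\Delta+1)/2\rceil$.
   Context: All graphs are finite, simple and undirected. A graph is $d$-degenerate if every subgraph of it has a vertex of degree at most $d$. A graph is claw-free if it has no induced subgraph isomorphic to $K_{1,3}$. A $k$-list assignment of a graph $G$ assigns to each vertex $v$ a set (list) $L(v)$ of $k$ colors. A graph $G$ is equitable list point $k$-arborable if for every $k$-list assignment $L$ one can choose $c(v)\in L(v)$ for each vertex $v$ such that each color class induces an acyclic subgraph (a forest) of $G$ and each color appears on at most $\lceil |V(G)|/k\rceil$ vertices of $G$. -}

module Defs where

open import Data.Nat using (ℕ; zero; suc; _+_; _∸_; _≤_; NonZero)
open import Data.Nat.DivMod using (_/_)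
open import Data.Bool using (Bool; true; false; T; not)
open import Data.Fin using (Fin; zero; suc; inject₁; fromℕ)
open import Data.List using (List; length; filterᵇ; allFin)
open import Data.List.Membership.Propositional using (_∈_)
open import Data.List.Relation.Unary.Unique.Propositional using (Unique)
open import Data.Product using (Σ; ∃; _×_; _,_)
open import Relation.Binary.PropositionalEquality using (_≡_; _≢_)
open import Relation.Nullary using (¬_)
open import Function.Definitions using (Injective)
open import Data.Nat using (_≡ᵇ_)

record Graph (n : ℕ) : Set where
  field
    adj   : Fin n → Fin n → Bool
    sym   : ∀ u v → adj u v ≡ adj v u
    irrefl : ∀ v → adj v v ≡ false
open Graph public

countᵇ : {n : ℕ} → (Fin n → Bool) → ℕ
countᵇ {n} p = length (filterᵇ p (allFin n))

_∧ᵇ_ : Bool → Bool → Bool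
true ∧ᵇ b = b
false ∧ᵇ b = false

degree : {n : ℕ} → Graph n → Fin n → ℕ
degree G v = countᵇ (adj G v)

MaxDegree : {n : ℕ} → Graph n → ℕ → Set
MaxDegree G Δ = (∀ v → degree G v ≤ Δ) × (∃ λ v → degree G v ≡ Δ)

record Subgraph {n : ℕ} (G : Graph n) : Set where
  field
    S : Fin n → Bool
    E : Fin n → Fin n → Bool
    E-sym : ∀ u v → E u v ≡ E v u
    E-⊆   : ∀ u v → T (E u v) → T (adj G u v)
    E-S   : ∀ u v → T (E u v) → T (S u) × T (S v)
open Subgraph public

subDegree : {n : ℕ} {G : Graph n} → Subgraph G → Fin n → ℕ
subDegree H v = countᵇ (λ u → S H u ∧ᵇ E H v u)

Degenerate : {n : ℕ} → ℕ → Graph n → Set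
Degenerate d G = (H : Subgraph G) → (∃ λ v → T (S H v)) →
                 ∃ λ v → T (S H v) × subDegree H v ≤ d

ClawFree : {n : ℕ} → Graph n → Set
ClawFree G = ¬ (Σ _ λ v → Σ _ λ a → Σ _ λ b → Σ _ λ c →
               a ≢ b × a ≢ c × b ≢ c ×
               T (adj G v a) × T (adj G v b) × T (adj G v c) ×
               T (not (adj G a b)) × T (not (adj G a c)) × T (not (adj G b c)))

Cycle : {n : ℕ} → Graph n → (Fin n → Set) → Set
Cycle {n} G P = Σ ℕ λ m → Σ (Fin (suc (suc (suc m))) → Fin n) λ f →
    Injective _≡_ _≡_ f ×
    (∀ i → P (f i)) ×
    (∀ (i : Fin (suc (suc m))) → T (adj G (f (inject₁ i)) (f (suc i)))) ×
    T (adj G (f (fromℕ (suc (suc m)))) (f zero))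

InducesForest : {n : ℕ} → Graph n → (Fin n → Set) → Set
InducesForest G P = ¬ Cycle G P

⌈_/_⌉ : ℕ → (k : ℕ) → .{{NonZero k}} → ℕ
⌈ m / k ⌉ = (m + (k ∸ 1)) / k

ListAssignment : ℕ → ℕ → Set
ListAssignment n k = Σ (Fin n → List ℕ) λ L → ∀ v → length (L v) ≡ k × Unique (L v)

EquitableListPointArborable : {n : ℕ} → Graph n → (k : ℕ) → .{{NonZero k}} → Set
EquitableListPointArborable {n} G k = (A : ListAssignment n k) →
  let L = Data.Product.proj₁ A in
  Σ (Fin n → ℕ) λ c →
    (∀ v → c v ∈ L v) ×
    (∀ (a : ℕ) → InducesForest G (λ v → c v ≡ a)) ×
    (∀ (a : ℕ) → countᵇ (λ v → c v ≡ᵇ a) ≤ ⌈ n / k ⌉)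

module Submission where

-- A colouring of a vertex set A is built by induction on |A|. Split off a block S of k vertices
-- (all of A if |A| ≤ k), colour A ∖ S by induction, and colour S vertex by vertex, giving each
-- vertex a colour from its list that is not yet used on S and occurs on at most one of its
-- neighbours outside S. Every colour class stays a forest and gains at most one vertex, so it
-- stays within ⌈|A|/k⌉. For the j-th vertex of S (counting from 0) with d neighbours outside S
-- such a colour exists as soon as 2j + d < 2k, by pigeonhole over its k colours. As Δ < 2k this
-- holds for the following order of S: a vertex x of degree at most 3 comes last, before it come
-- vertices of degree at most 3 peeled off by 3-degeneracy, and first come up to two neighbours
-- of x, adjacent to each other when x has three (claw-freeness), so that x keeps at most one
-- neighbour outside S.

open import Defs
open import Data.Nat using (ℕ; _≤_; NonZero; ⌈_/2⌉; _+_)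

open import Algebra.Properties.CommutativeSemigroup using (interchange; xy∙z≈xz∙y)
open import Data.Bool using (Bool; true; false; T; not; _∧_; _∨_; if_then_else_)
open import Data.Bool.Properties using (T?)
open import Data.Empty using (⊥-elim)
open import Data.Fin using (Fin; zero; suc; inject₁; fromℕ) renaming (_≟_ to _≟ᶠ_)
open import Data.Fin.Properties as Fin using (any?)
open import Data.Fin.Relation.Unary.Top using (view; ‵fromℕ; ‵inject₁)
open import Data.List using (List; []; _∷_; [_]; _++_; length; filterᵇ; allFin; tabulate; map)
open import Data.List.Membership.Propositional using (_∈_; _∉_)
open import Data.List.Membership.Propositional.Properties
  using (∈-filter⁺; ∈-allFin; ∈-++⁺ˡ; ∈-++⁺ʳ; ∈-++⁻)
open import Data.List.Properties using (length-++)
open import Data.List.Relation.Unary.All as All using (All; []; _∷_)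
open import Data.List.Relation.Unary.All.Properties using (all-filter) renaming (++⁺ to ++⁺ᴬ)
open import Data.List.Relation.Unary.AllPairs using ([]; _∷_)
open import Data.List.Relation.Unary.Any using (here; there)
open import Data.List.Relation.Unary.Unique.Propositional using (Unique)
open import Data.List.Relation.Unary.Unique.Propositional.Properties using (filter⁺; allFin⁺; ++⁺)
open import Data.Nat using (zero; suc; _<_; _∸_; _≡ᵇ_; _≤?_; _<?_; z≤n; s≤s; ⌊_/2⌋)
open import Data.Nat.DivMod using (_/_; m<n⇒m/n≡0; m≥n⇒m/n>0; m/n≡1+[m∸n]/n)
open import Data.Nat.ListAction using (sum)
open import Data.Nat.Properties
open import Data.Nat.Tactic.RingSolver using (solve-∀)
open import Data.Product using (Σ; ∃; ∃₂; _×_; _,_; proj₁; proj₂)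
open import Data.Sum using (_⊎_; inj₁; inj₂; [_,_]′)
open import Data.Unit using (⊤; tt)
open import Data.Vec.Functional using (updateAt)
open import Data.Vec.Functional.Properties using (updateAt-updates; updateAt-minimal)
open import Function using (_∘_; const; case_of_)
open import Relation.Binary.PropositionalEquality
  using (_≡_; _≢_; refl; trans; cong; cong₂; subst; subst₂; module ≡-Reasoning) renaming (sym to ≡-sym)
open import Relation.Nullary using (¬_; yes; no; contradiction)
open import Relation.Nullary.Decidable using (isYes; toWitness; fromWitness)

private
  variable
    n : ℕ

-- Vertex sets

VSet : ℕ → Set
VSet n = Fin n → Bool

module _ {n : ℕ} where

  open import Data.List.Membership.DecPropositional (_≟ᶠ_ {n}) using (_∈?_)

  infix 4 _⊆_
  infixl 6 _∖_
  infixl 7 _∩_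
  infixl 6 _∪_

  -- A record, so that P and Q can be inferred from a proof of P ⊆ Q.
  record _⊆_ (P Q : VSet n) : Set where
    constructor mk⊆
    field ⊆⇒ : ∀ {v} → T (P v) → T (Q v)
  open _⊆_ public

  _∩_ _∪_ : VSet n → VSet n → VSet n
  (P ∩ Q) v = P v ∧ Q v
  (P ∪ Q) v = P v ∨ Q v

  ⟦_⟧ : List (Fin n) → VSet n
  ⟦ xs ⟧ v = isYes (v ∈? xs)

  ∁ : VSet n → VSet n
  ∁ P v = not (P v)

  _∖_ : VSet n → List (Fin n) → VSet n
  P ∖ xs = P ∩ ∁ ⟦ xs ⟧

  ∅ : VSet n
  ∅ _ = false

  _⁻¹_ : (Fin n → ℕ) → ℕ → VSet n
  (c ⁻¹ a) v = c v ≡ᵇ a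

  module _ (P Q : VSet n) {v : Fin n} where

    ∩⁺ : T (P v) → T (Q v) → T ((P ∩ Q) v)
    ∩⁺ p q with P v | Q v
    ... | true | true = tt

    ∩⁻ : T ((P ∩ Q) v) → T (P v) × T (Q v)
    ∩⁻ t with P v | Q v
    ... | true | true = tt , tt

    ∪⁺ˡ : T (P v) → T ((P ∪ Q) v)
    ∪⁺ˡ p with P v
    ... | true = tt

    ∪⁺ʳ : T (Q v) → T ((P ∪ Q) v)
    ∪⁺ʳ q with P v | Q v
    ... | true | _ = tt
    ... | false | true = tt

    ∪⁻ : T ((P ∪ Q) v) → T (P v) ⊎ T (Q v)
    ∪⁻ t with P v
    ... | true = inj₁ tt
    ... | false = inj₂ t

  module _ (xs : List (Fin n)) {v : Fin n} where

    ⟦⟧⁺ : v ∈ xs → T (⟦ xs ⟧ v)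
    ⟦⟧⁺ = fromWitness

    ⟦⟧⁻ : T (⟦ xs ⟧ v) → v ∈ xs
    ⟦⟧⁻ = toWitness

  module _ (P : VSet n) {v : Fin n} where

    ∁⁺ : ¬ T (P v) → T (∁ P v)
    ∁⁺ ¬p with P v
    ... | true  = ¬p tt
    ... | false = tt

    ∁⁻ : T (∁ P v) → ¬ T (P v)
    ∁⁻ t with P v
    ... | false = λ ()

  module _ (P : VSet n) (xs : List (Fin n)) {v : Fin n} where

    ∖⁺ : T (P v) → v ∉ xs → T ((P ∖ xs) v)
    ∖⁺ p v∉ = ∩⁺ P (∁ ⟦ xs ⟧) p (∁⁺ ⟦ xs ⟧ (v∉ ∘ ⟦⟧⁻ xs))

    ∖⁻ : T ((P ∖ xs) v) → T (P v) × v ∉ xs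
    ∖⁻ t = let p , ¬v = ∩⁻ P (∁ ⟦ xs ⟧) t in p , ∁⁻ ⟦ xs ⟧ ¬v ∘ ⟦⟧⁺ xs

  ∖-anti : (P : VSet n) (xs ys : List (Fin n)) → (∀ {v} → v ∈ xs → v ∈ ys) → P ∖ ys ⊆ P ∖ xs
  ⊆⇒ (∖-anti P xs ys xs⊆ys) t = let p , ∉ys = ∖⁻ P ys t in ∖⁺ P xs p (∉ys ∘ xs⊆ys)

  ∖-⊆ : (P : VSet n) (xs : List (Fin n)) → P ∖ xs ⊆ P
  ⊆⇒ (∖-⊆ P xs) t = proj₁ (∖⁻ P xs t)

  ⊆-trans : {P Q R : VSet n} → P ⊆ Q → Q ⊆ R → P ⊆ R
  ⊆⇒ (⊆-trans P⊆Q Q⊆R) = ⊆⇒ Q⊆R ∘ ⊆⇒ P⊆Q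

  ∩-⊆ˡ : (P Q : VSet n) → P ∩ Q ⊆ P
  ⊆⇒ (∩-⊆ˡ P Q) t = proj₁ (∩⁻ P Q t)

  ∩-⊆ʳ : (P Q : VSet n) → P ∩ Q ⊆ Q
  ⊆⇒ (∩-⊆ʳ P Q) t = proj₂ (∩⁻ P Q t)

  ∩-monoˡ : {P Q : VSet n} (R : VSet n) → P ⊆ Q → P ∩ R ⊆ Q ∩ R
  ⊆⇒ (∩-monoˡ {P} {Q} R P⊆Q) t = let p , r = ∩⁻ P R t in ∩⁺ Q R (⊆⇒ P⊆Q p) r

  ∪-monoʳ : {Q R : VSet n} (P : VSet n) → Q ⊆ R → P ∪ Q ⊆ P ∪ R
  ⊆⇒ (∪-monoʳ {Q} {R} P Q⊆R) t = [ ∪⁺ˡ P R , ∪⁺ʳ P R ∘ ⊆⇒ Q⊆R ]′ (∪⁻ P Q t)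

  ∪-∅ : (P : VSet n) → P ∪ ∅ ⊆ P
  ⊆⇒ (∪-∅ P) t = [ (λ p → p) , (λ ()) ]′ (∪⁻ P ∅ t)

  ∩-distribʳ-∪ : (P Q R : VSet n) → (P ∪ Q) ∩ R ⊆ P ∩ R ∪ Q ∩ R
  ⊆⇒ (∩-distribʳ-∪ P Q R) t with ∩⁻ (P ∪ Q) R t
  ... | pq , r = [ (λ p → ∪⁺ˡ (P ∩ R) (Q ∩ R) (∩⁺ P R p r))
                 , (λ q → ∪⁺ʳ (P ∩ R) (Q ∩ R) (∩⁺ Q R q r)) ]′ (∪⁻ P Q pq)

  ∖-++ : (P : VSet n) (xs ys : List (Fin n)) → P ∖ (xs ++ ys) ⊆ P ∖ xs ∖ ys
  ⊆⇒ (∖-++ P xs ys) t =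
    let p , v∉ = ∖⁻ P (xs ++ ys) t
    in ∖⁺ (P ∖ xs) ys (∖⁺ P xs p (v∉ ∘ ∈-++⁺ˡ)) (v∉ ∘ ∈-++⁺ʳ xs)

  ∖-++⁻ : (P : VSet n) (xs ys : List (Fin n)) → P ∖ xs ∖ ys ⊆ P ∖ (xs ++ ys)
  ⊆⇒ (∖-++⁻ P xs ys) t =
    let p-xs , v∉ys = ∖⁻ (P ∖ xs) ys t ; p , v∉xs = ∖⁻ P xs p-xs
    in ∖⁺ P (xs ++ ys) p ([ v∉xs , v∉ys ]′ ∘ ∈-++⁻ xs)

  ⁻¹⁺ : ∀ (c : Fin n → ℕ) {a v} → c v ≡ a → T ((c ⁻¹ a) v)
  ⁻¹⁺ c {a} {v} = ≡⇒≡ᵇ (c v) a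

  ⁻¹⁻ : ∀ (c : Fin n → ℕ) {a v} → T ((c ⁻¹ a) v) → c v ≡ a
  ⁻¹⁻ c {a} {v} = ≡ᵇ⇒≡ (c v) a

∪-singleton⁻ : (P : VSet n) {x v : Fin n} → T ((P ∪ ⟦ [ x ] ⟧) v) → T (P v) ⊎ v ≡ x
∪-singleton⁻ P {x} t with ∪⁻ P ⟦ [ x ] ⟧ t
... | inj₁ p = inj₁ p
... | inj₂ s with ⟦⟧⁻ [ x ] s
...   | here v≡x = inj₂ v≡x

∪-∪-singleton⁻ : (P Q : VSet n) {x v : Fin n} → T ((P ∪ (Q ∪ ⟦ [ x ] ⟧)) v) → T ((P ∪ Q) v) ⊎ v ≡ x
∪-∪-singleton⁻ P Q {x} t with ∪⁻ P (Q ∪ ⟦ [ x ] ⟧) t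
... | inj₁ p = inj₁ (∪⁺ˡ P Q p)
... | inj₂ q with ∪-singleton⁻ Q {x} q
...   | inj₁ q′  = inj₁ (∪⁺ʳ P Q q′)
...   | inj₂ v≡x = inj₂ v≡x

-- Counting

count : VSet n → ℕ
count {zero}  P = 0
count {suc n} P = (if P zero then 1 else 0) + count (P ∘ suc)

count-mono : {P Q : VSet n} → P ⊆ Q → count P ≤ count Q
count-mono {zero}  P⊆Q = z≤n
count-mono {suc n} {P} {Q} (mk⊆ P⊆Q) with P zero | Q zero | P⊆Q {zero}
... | true  | true  | _  = s≤s (count-mono (mk⊆ λ {v} → P⊆Q {suc v}))
... | true  | false | P0 = ⊥-elim (P0 tt)
... | false | true  | _  = m≤n⇒m≤1+n (count-mono (mk⊆ λ {v} → P⊆Q {suc v}))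
... | false | false | _  = count-mono (mk⊆ λ {v} → P⊆Q {suc v})

count-cong : {P Q : VSet n} → P ⊆ Q → Q ⊆ P → count P ≡ count Q
count-cong P⊆Q Q⊆P = ≤-antisym (count-mono P⊆Q) (count-mono Q⊆P)

count-≗ : {P Q : VSet n} → (∀ v → P v ≡ Q v) → count P ≡ count Q
count-≗ P≗Q = count-cong (mk⊆ λ {v} → subst T (P≗Q v)) (mk⊆ λ {v} → subst T (≡-sym (P≗Q v)))

count-∅ : count {n} ∅ ≡ 0
count-∅ {zero}  = refl
count-∅ {suc n} = count-∅ {n}

count-full : count {n} (const true) ≡ n
count-full {zero}  = refl
count-full {suc n} = cong suc (count-full {n})

count-∪ : (P Q : VSet n) → count (P ∪ Q) ≤ count P + count Q
count-∪ {zero}  P Q = z≤n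
count-∪ {suc n} P Q with P zero | Q zero
... | true  | true  = s≤s (≤-trans (count-∪ (P ∘ suc) (Q ∘ suc)) (+-monoʳ-≤ (count (P ∘ suc)) (n≤1+n _)))
... | true  | false = s≤s (count-∪ (P ∘ suc) (Q ∘ suc))
... | false | true  = ≤-trans (s≤s (count-∪ (P ∘ suc) (Q ∘ suc))) (≤-reflexive (≡-sym (+-suc _ _)))
... | false | false = count-∪ (P ∘ suc) (Q ∘ suc)

count-partition : (P Q : VSet n) → count P ≡ count (P ∩ Q) + count (P ∩ ∁ Q)
count-partition {zero}  P Q = refl
count-partition {suc n} P Q with P zero | Q zero
... | true  | true  = cong suc (count-partition (P ∘ suc) (Q ∘ suc))
... | true  | false = trans (cong suc (count-partition (P ∘ suc) (Q ∘ suc))) (≡-sym (+-suc _ _))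
... | false | _     = count-partition (P ∘ suc) (Q ∘ suc)

count-singleton : (x : Fin n) → count ⟦ [ x ] ⟧ ≡ 1
count-singleton {suc n} zero    = cong suc (trans (count-cong ⊆∅ (mk⊆ λ ())) (count-∅ {n}))
  where
  ⊆∅ : ⟦ [ zero {n} ] ⟧ ∘ suc ⊆ ∅
  ⊆∅ = mk⊆ λ {v} t → case ⟦⟧⁻ [ zero ] {suc v} t of λ { (here ()) }
count-singleton {suc n} (suc x) = trans (count-cong ⊆x x⊆) (count-singleton x)
  where
  ⊆x : ⟦ [ suc x ] ⟧ ∘ suc ⊆ ⟦ [ x ] ⟧
  ⊆x = mk⊆ λ {v} t → case ⟦⟧⁻ [ suc x ] {suc v} t of λ { (here refl) → ⟦⟧⁺ [ x ] (here refl) }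
  x⊆ : ⟦ [ x ] ⟧ ⊆ ⟦ [ suc x ] ⟧ ∘ suc
  x⊆ = mk⊆ λ {v} t → case ⟦⟧⁻ [ x ] {v} t of λ { (here refl) → ⟦⟧⁺ [ suc x ] (here refl) }

count-∖-one : (P : VSet n) (x : Fin n) → T (P x) → count P ≡ suc (count (P ∖ [ x ]))
count-∖-one P x px = begin
  count P                                    ≡⟨ count-partition P ⟦ [ x ] ⟧ ⟩
  count (P ∩ ⟦ [ x ] ⟧) + count (P ∖ [ x ]) ≡⟨ cong (_+ count (P ∖ [ x ])) (count-cong ⊆x x⊆) ⟩
  count ⟦ [ x ] ⟧ + count (P ∖ [ x ])       ≡⟨ cong (_+ count (P ∖ [ x ])) (count-singleton x) ⟩
  suc (count (P ∖ [ x ]))                    ∎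
  where
  open ≡-Reasoning
  ⊆x : P ∩ ⟦ [ x ] ⟧ ⊆ ⟦ [ x ] ⟧
  ⊆x = mk⊆ λ t → proj₂ (∩⁻ P ⟦ [ x ] ⟧ t)
  x⊆ : ⟦ [ x ] ⟧ ⊆ P ∩ ⟦ [ x ] ⟧
  x⊆ = mk⊆ λ {v} t → case ⟦⟧⁻ [ x ] {v} t of λ { (here refl) → ∩⁺ P ⟦ [ x ] ⟧ px t }

count-insert : (P : VSet n) (x : Fin n) → ¬ T (P x) → count (P ∪ ⟦ [ x ] ⟧) ≡ suc (count P)
count-insert P x x∉P =
  trans (count-∖-one (P ∪ ⟦ [ x ] ⟧) x (∪⁺ʳ P ⟦ [ x ] ⟧ (⟦⟧⁺ [ x ] (here refl))))
        (cong suc (count-cong ⊆P P⊆))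
  where
  ⊆P : P ∪ ⟦ [ x ] ⟧ ∖ [ x ] ⊆ P
  ⊆⇒ ⊆P t with ∖⁻ (P ∪ ⟦ [ x ] ⟧) [ x ] t
  ... | p∪x , v∉x = [ (λ p → p) , (λ { refl → contradiction (here refl) v∉x }) ]′ (∪-singleton⁻ P p∪x)
  P⊆ : P ⊆ P ∪ ⟦ [ x ] ⟧ ∖ [ x ]
  ⊆⇒ P⊆ p = ∖⁺ (P ∪ ⟦ [ x ] ⟧) [ x ] (∪⁺ˡ P ⟦ [ x ] ⟧ p) λ { (here refl) → x∉P p }

count-∖ : (P : VSet n) (xs : List (Fin n)) → Unique xs → All (T ∘ P) xs →
          count P ≡ count (P ∖ xs) + length xs
count-∖ P [] _ _ = trans (count-cong P⊆P∖[] (∖-⊆ P [])) (≡-sym (+-identityʳ _))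
  where
  P⊆P∖[] : P ⊆ P ∖ []
  ⊆⇒ P⊆P∖[] p = ∖⁺ P [] p λ ()
count-∖ P (x ∷ xs) (x∉xs ∷ u) (px ∷ pxs) = begin
  count P                                  ≡⟨ count-∖-one P x px ⟩
  suc (count (P ∖ [ x ]))                  ≡⟨ cong suc (count-∖ (P ∖ [ x ]) xs u pxs′) ⟩
  suc (count (P ∖ [ x ] ∖ xs) + length xs) ≡⟨ cong (λ m → suc (m + length xs))
                                                    (count-cong (∖-++⁻ P [ x ] xs) (∖-++ P [ x ] xs)) ⟩
  suc (count (P ∖ (x ∷ xs)) + length xs)   ≡⟨ ≡-sym (+-suc _ (length xs)) ⟩
  count (P ∖ (x ∷ xs)) + length (x ∷ xs)   ∎
  where
  open ≡-Reasoning
  pxs′ : All (T ∘ (P ∖ [ x ])) xs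
  pxs′ = All.zipWith (λ (x≢y , py) → ∖⁺ P [ x ] py λ { (here refl) → x≢y refl }) (x∉xs , pxs)

length≤count : (P : VSet n) (xs : List (Fin n)) → Unique xs → All (T ∘ P) xs → length xs ≤ count P
length≤count P xs u pxs = ≤-trans (m≤n+m (length xs) _) (≤-reflexive (≡-sym (count-∖ P xs u pxs)))

count-⊆-∖ : (P Q : VSet n) (xs : List (Fin n)) → Unique xs → All (T ∘ P) xs → Q ⊆ P ∖ xs →
            length xs + count Q ≤ count P
count-⊆-∖ P Q xs u pxs Q⊆ = begin
  length xs + count Q       ≤⟨ +-monoʳ-≤ (length xs) (count-mono Q⊆) ⟩
  length xs + count (P ∖ xs) ≡⟨ +-comm (length xs) _ ⟩
  count (P ∖ xs) + length xs ≡⟨ ≡-sym (count-∖ P xs u pxs) ⟩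
  count P                    ∎
  where open ≤-Reasoning

count≡0⇒∉ : (P : VSet n) → count P ≡ 0 → ∀ v → ¬ T (P v)
count≡0⇒∉ P P≡0 v p with trans (≡-sym P≡0) (count-∖-one P v p)
... | ()

count>0⇒∃ : (P : VSet n) → 0 < count P → ∃ λ v → T (P v)
count>0⇒∃ {suc n} P h with P zero in eq
... | true  = zero , subst T (≡-sym eq) tt
... | false = let v , p = count>0⇒∃ (P ∘ suc) h in suc v , p

count≤1⇒≡ : (P : VSet n) → count P ≤ 1 → ∀ {u w} → T (P u) → T (P w) → u ≡ w
count≤1⇒≡ P P≤1 {u} {w} pu pw with u ≟ᶠ w
... | yes u≡w = u≡w
... | no u≢w  = contradiction (≤-trans two≤P P≤1) λ { (s≤s ()) }
  where
  two≤P : 2 ≤ count P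
  two≤P = length≤count P (u ∷ w ∷ []) ((u≢w ∷ []) ∷ [] ∷ []) (pu ∷ pw ∷ [])

count-⊆-singleton : (P : VSet n) (x : Fin n) → P ⊆ ⟦ [ x ] ⟧ → count P ≤ 1
count-⊆-singleton P x P⊆x = ≤-trans (count-mono P⊆x) (≤-reflexive (count-singleton x))

elements : VSet n → List (Fin n)
elements {n} P = filterᵇ P (allFin n)

elements-unique : (P : VSet n) → Unique (elements P)
elements-unique {n} P = filter⁺ (T? ∘ P) (allFin⁺ n)

elements-⊆ : (P : VSet n) → All (T ∘ P) (elements P)
elements-⊆ {n} P = all-filter (T? ∘ P) (allFin n)

∈-elements : (P : VSet n) {v : Fin n} → T (P v) → v ∈ elements P
∈-elements P {v} = ∈-filter⁺ (T? ∘ P) (∈-allFin v)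

length-filterᵇ-tabulate : {A : Set} (p : A → Bool) (f : Fin n → A) →
                          length (filterᵇ p (tabulate f)) ≡ count (p ∘ f)
length-filterᵇ-tabulate {zero}  p f = refl
length-filterᵇ-tabulate {suc n} p f with p (f zero)
... | true  = cong suc (length-filterᵇ-tabulate p (f ∘ suc))
... | false = length-filterᵇ-tabulate p (f ∘ suc)

countᵇ≡count : (P : VSet n) → countᵇ P ≡ count P
countᵇ≡count P = length-filterᵇ-tabulate P (λ v → v)

length-elements : (P : VSet n) → length (elements P) ≡ count P
length-elements = countᵇ≡count

-- Degrees and cycles

module _ (G : Graph n) where

  degreeIn : VSet n → Fin n → ℕ
  degreeIn D x = count (D ∩ adj G x)

  degreeIn-mono : {D D′ : VSet n} → D ⊆ D′ → ∀ x → degreeIn D x ≤ degreeIn D′ x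
  degreeIn-mono D⊆D′ x = count-mono (∩-monoˡ (adj G x) D⊆D′)

  Acyclic : VSet n → Set
  Acyclic P = InducesForest G (T ∘ P)

  adj-sym : ∀ {u w} → T (adj G u w) → T (adj G w u)
  adj-sym {u} {w} = subst T (Graph.sym G u w)

  adj⇒≢ : ∀ {u w} → T (adj G u w) → u ≢ w
  adj⇒≢ {u} uw refl = subst T (irrefl G u) uw

  Cycle-map : {P Q : Fin n → Set} → (∀ {v} → P v → Q v) → Cycle G P → Cycle G Q
  Cycle-map P⇒Q (m , f , inj , inP , edge , close) = m , f , inj , P⇒Q ∘ inP , edge , close

  Acyclic-anti : {P Q : VSet n} → P ⊆ Q → Acyclic Q → Acyclic P
  Acyclic-anti P⊆Q acyclic = acyclic ∘ Cycle-map (λ {v} → ⊆⇒ P⊆Q {v})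

  cycle-neighbours : ∀ m (f : Fin (3 + m) → Fin n) →
    (∀ (i : Fin (2 + m)) → T (adj G (f (inject₁ i)) (f (suc i)))) →
    T (adj G (f (fromℕ (2 + m))) (f zero)) →
    ∀ i → ∃₂ λ p s → p ≢ s × T (adj G (f i) (f p)) × T (adj G (f i) (f s))
  cycle-neighbours m f edge close zero = fromℕ (2 + m) , suc zero , (λ ()) , adj-sym close , edge zero
  cycle-neighbours m f edge close (suc j) with view j
  ... | ‵fromℕ      = inject₁ j , zero , (λ ()) , adj-sym (edge j) , close
  ... | ‵inject₁ j′ = inject₁ j , suc (suc j′) , inject₁²≢suc² j′ , adj-sym (edge j) , edge (suc j′)
    where
    inject₁²≢suc² : ∀ {k} (i : Fin k) → inject₁ (inject₁ i) ≢ suc (suc i)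
    inject₁²≢suc² zero    ()
    inject₁²≢suc² (suc i) eq = inject₁²≢suc² i (Fin.suc-injective eq)

  forest-insert : {P : Fin n → Set} (x : Fin n) → InducesForest G P →
    (∀ {u w} → P u → P w → T (adj G x u) → T (adj G x w) → u ≡ w) →
    InducesForest G (λ v → P v ⊎ v ≡ x)
  forest-insert {P} x acyclic x-unique (m , f , inj , inP , edge , close)
    with any? (λ i → f i ≟ᶠ x)
  ... | no x∉f = acyclic (m , f , inj , inP′ , edge , close)
    where
    inP′ : ∀ i → P (f i)
    inP′ i with inP i
    ... | inj₁ p   = p
    ... | inj₂ fi≡x = contradiction (i , fi≡x) x∉f
  ... | yes (i , refl) =
    let p , s , p≢s , ip , is = cycle-neighbours m f edge close i
    in p≢s (inj (x-unique (inP-nbr ip) (inP-nbr is) ip is))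
    where
    inP-nbr : ∀ {j} → T (adj G (f i) (f j)) → P (f j)
    inP-nbr {j} a with inP j
    ... | inj₁ p    = p
    ... | inj₂ fj≡x = contradiction (≡-sym fj≡x) (adj⇒≢ a)

-- Choosing a colour

pigeonhole : (w : ℕ → ℕ) (xs : List ℕ) → sum (map w xs) < length xs + length xs →
             ∃ λ a → a ∈ xs × w a ≤ 1
pigeonhole w (a ∷ xs) h with w a ≤? 1
... | yes wa≤1 = a , here refl , wa≤1
... | no  wa≰1 = let b , b∈xs , wb≤1 = pigeonhole w xs rest< in b , there b∈xs , wb≤1
  where
  open ≤-Reasoning
  rest< : sum (map w xs) < length xs + length xs
  rest< = +-cancelˡ-< 2 _ _ (begin-strict
    2 + sum (map w xs)                ≤⟨ +-monoˡ-≤ _ (≰⇒> wa≰1) ⟩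
    w a + sum (map w xs)              <⟨ h ⟩
    suc (length xs) + suc (length xs) ≡⟨ cong suc (+-suc _ _) ⟩
    2 + (length xs + length xs)       ∎)

sum-map-+ : (f g : ℕ → ℕ) (xs : List ℕ) →
            sum (map (λ a → f a + g a) xs) ≡ sum (map f xs) + sum (map g xs)
sum-map-+ f g []       = refl
sum-map-+ f g (a ∷ xs) = trans (cong (f a + g a +_) (sum-map-+ f g xs))
                               (interchange +-commutativeSemigroup (f a) (g a) (sum (map f xs)) (sum (map g xs)))

sum-map-mono : {f g : ℕ → ℕ} (xs : List ℕ) → All (λ a → f a ≤ g a) xs → sum (map f xs) ≤ sum (map g xs)
sum-map-mono []       []             = z≤n
sum-map-mono (a ∷ xs) (fa≤ga ∷ f≤g) = +-mono-≤ fa≤ga (sum-map-mono xs f≤g)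

colour-classes-sum : (P : VSet n) (c : Fin n → ℕ) (xs : List ℕ) → Unique xs →
                     sum (map (λ a → count (P ∩ c ⁻¹ a)) xs) ≤ count P
colour-classes-sum P c []       _             = z≤n
colour-classes-sum P c (a ∷ xs) (a∉xs ∷ u) = begin
  count (P ∩ c ⁻¹ a) + sum (map (λ b → count (P ∩ c ⁻¹ b)) xs)
    ≤⟨ +-monoʳ-≤ (count (P ∩ c ⁻¹ a)) (sum-map-mono xs (All.map (count-mono ∘ class⊆) a∉xs)) ⟩
  count (P ∩ c ⁻¹ a) + sum (map (λ b → count (P ∩ ∁ (c ⁻¹ a) ∩ c ⁻¹ b)) xs)
    ≤⟨ +-monoʳ-≤ (count (P ∩ c ⁻¹ a)) (colour-classes-sum (P ∩ ∁ (c ⁻¹ a)) c xs u) ⟩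
  count (P ∩ c ⁻¹ a) + count (P ∩ ∁ (c ⁻¹ a))
    ≡⟨ ≡-sym (count-partition P (c ⁻¹ a)) ⟩
  count P ∎
  where
  open ≤-Reasoning
  class⊆ : ∀ {b} → a ≢ b → P ∩ c ⁻¹ b ⊆ P ∩ ∁ (c ⁻¹ a) ∩ c ⁻¹ b
  class⊆ {b} a≢b = mk⊆ λ {v} t →
    let p , cv≡b = ∩⁻ P (c ⁻¹ b) t
        cv≢a = λ cv≡a → a≢b (trans (≡-sym (⁻¹⁻ c {a} {v} cv≡a)) (⁻¹⁻ c cv≡b))
    in ∩⁺ (P ∩ ∁ (c ⁻¹ a)) (c ⁻¹ b) (∩⁺ P (∁ (c ⁻¹ a)) p (∁⁺ (c ⁻¹ a) cv≢a)) cv≡b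

free-colour : (P Q : VSet n) (c : Fin n → ℕ) (xs : List ℕ) → Unique xs →
              count P + count P + count Q < length xs + length xs →
              ∃ λ a → a ∈ xs × count (P ∩ c ⁻¹ a) ≡ 0 × count (Q ∩ c ⁻¹ a) ≤ 1
free-colour P Q c xs u h =
  let a , a∈xs , wa≤1 = pigeonhole w xs sum<
  in a , a∈xs , m+m+k≤1⇒m≡0 wa≤1 , m+n≤o⇒n≤o (#P a + #P a) wa≤1
  where
  #P #Q w : ℕ → ℕ
  #P a = count (P ∩ c ⁻¹ a)
  #Q a = count (Q ∩ c ⁻¹ a)
  w a  = #P a + #P a + #Q a
  open ≤-Reasoning
  sum< : sum (map w xs) < length xs + length xs
  sum< = begin-strict
    sum (map w xs)
      ≡⟨ sum-map-+ (λ a → #P a + #P a) #Q xs ⟩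
    sum (map (λ a → #P a + #P a) xs) + sum (map #Q xs)
      ≡⟨ cong (_+ sum (map #Q xs)) (sum-map-+ #P #P xs) ⟩
    sum (map #P xs) + sum (map #P xs) + sum (map #Q xs)
      ≤⟨ +-mono-≤ (+-mono-≤ (colour-classes-sum P c xs u) (colour-classes-sum P c xs u))
                  (colour-classes-sum Q c xs u) ⟩
    count P + count P + count Q
      <⟨ h ⟩
    length xs + length xs ∎
  m+m+k≤1⇒m≡0 : ∀ {m k} → m + m + k ≤ 1 → m ≡ 0
  m+m+k≤1⇒m≡0 {zero}  _ = refl
  m+m+k≤1⇒m≡0 {suc m} {k} (s≤s h) with subst (_≤ 0) (cong (_+ k) (+-suc m m)) h
  ... | ()

-- Colouring a block greedily

module _ (G : Graph n) (k : ℕ) where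

  -- xs can be coloured greedily in this order after j vertices of its block, next to the coloured
  -- set D: by free-colour a vertex with 2j + (its degree into D) < 2k has a colour left.
  Admissible : VSet n → ℕ → List (Fin n) → Set
  Admissible D j []       = ⊤
  Admissible D j (x ∷ xs) = j + j + degreeIn G D x < k + k × Admissible D (suc j) xs

  Admissible-anti : ∀ {D D′} j xs → D ⊆ D′ → Admissible D′ j xs → Admissible D j xs
  Admissible-anti j []       D⊆D′ _           = tt
  Admissible-anti j (x ∷ xs) D⊆D′ (room , adm) =
    ≤-trans (s≤s (+-monoʳ-≤ (j + j) (degreeIn-mono G D⊆D′ x))) room , Admissible-anti (suc j) xs D⊆D′ adm

  Admissible-++ : ∀ {D} j xs ys → Admissible D j xs → Admissible D (j + length xs) ys → Admissible D j (xs ++ ys)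
  Admissible-++ {D} j [] ys _ adm = subst (λ i → Admissible D i ys) (+-identityʳ j) adm
  Admissible-++ {D} j (x ∷ xs) ys (room , adm) adm′ =
    room , Admissible-++ (suc j) xs ys adm (subst (λ i → Admissible D i ys) (+-suc j (length xs)) adm′)

  Admissible-low-degree : ∀ {D} {e} j xs → All (λ x → degreeIn G D x ≤ e) xs →
    (j + length xs) + (j + length xs) + e ≤ suc (k + k) → Admissible D j xs
  Admissible-low-degree j []       _             _ = tt
  Admissible-low-degree {D} {e} j (x ∷ xs) (dx≤e ∷ low) fits =
    ≤-pred (begin
      suc (suc (j + j + degreeIn G D x)) ≤⟨ s≤s (s≤s (+-monoʳ-≤ (j + j) dx≤e)) ⟩
      suc (suc (j + j + e))              ≡⟨ cong (_+ e) (cong suc (≡-sym (+-suc j j))) ⟩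
      suc j + suc j + e                  ≤⟨ +-monoˡ-≤ e (+-mono-≤ j<s j<s) ⟩
      s + s + e                          ≤⟨ fits ⟩
      suc (k + k)                        ∎) ,
    Admissible-low-degree (suc j) xs low (subst (λ i → i + i + e ≤ suc (k + k)) (+-suc j (length xs)) fits)
    where
    open ≤-Reasoning
    s = j + length (x ∷ xs)
    j<s : suc j ≤ s
    j<s = ≤-trans (s≤s (m≤m+n j (length xs))) (≤-reflexive (≡-sym (+-suc j (length xs))))

module Greedy (G : Graph n) (k : ℕ) (L : Fin n → List ℕ)
              (L-ok : ∀ v → length (L v) ≡ k × Unique (L v))
              (A′ : VSet n) (m : ℕ) where

  -- A′ is coloured already, with at most m vertices per colour; B is the coloured part of the block.
  record BlockColouring (B : VSet n) (c : Fin n → ℕ) : Set where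
    field
      in-lists : ∀ v → c v ∈ L v
      forest   : ∀ a → Acyclic G ((A′ ∪ B) ∩ c ⁻¹ a)
      capacity : ∀ a → count (A′ ∩ c ⁻¹ a) ≤ m
      rainbow  : ∀ a → count (B ∩ c ⁻¹ a) ≤ 1

  BlockColouring-anti : ∀ {B B₁ c} → B₁ ⊆ B → BlockColouring B c → BlockColouring B₁ c
  BlockColouring-anti {c = c} B₁⊆B bc = record
    { in-lists = in-lists
    ; forest   = λ a → Acyclic-anti G (∩-monoˡ (c ⁻¹ a) (∪-monoʳ A′ B₁⊆B)) (forest a)
    ; capacity = capacity
    ; rainbow  = λ a → ≤-trans (count-mono (∩-monoˡ (c ⁻¹ a) B₁⊆B)) (rainbow a)
    }
    where open BlockColouring bc

  module _ {B : VSet n} {c : Fin n → ℕ} (bc : BlockColouring B c) (x : Fin n) (x-new : ¬ T ((A′ ∪ B) x))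
           {a : ℕ} (a∈Lx : a ∈ L x) (a-unused : count (B ∩ c ⁻¹ a) ≡ 0)
           (a-rare : count (A′ ∩ adj G x ∩ c ⁻¹ a) ≤ 1) where

    private
      open BlockColouring bc
      c₁ = updateAt c x (const a)
      B₁ = B ∪ ⟦ [ x ] ⟧

      recoloured : ∀ {b v} → T ((c₁ ⁻¹ b) v) → (v ≡ x × a ≡ b) ⊎ (v ≢ x × T ((c ⁻¹ b) v))
      recoloured {b} {v} t with v ≟ᶠ x
      ... | yes refl = inj₁ (refl , trans (≡-sym (updateAt-updates x c)) (⁻¹⁻ c₁ t))
      ... | no v≢x   = inj₂ (v≢x , ⁻¹⁺ c (trans (≡-sym (updateAt-minimal v x c v≢x)) (⁻¹⁻ c₁ t)))

      old-vertex : ∀ {v} → v ≢ x → T ((A′ ∪ B₁) v) → T ((A′ ∪ B) v)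
      old-vertex v≢x t = [ (λ ab → ab) , (λ v≡x → contradiction v≡x v≢x) ]′ (∪-∪-singleton⁻ A′ B t)

      a∉B : ∀ {v} → T ((c ⁻¹ a) v) → ¬ T (B v)
      a∉B {v} ca b = count≡0⇒∉ (B ∩ c ⁻¹ a) a-unused v (∩⁺ B (c ⁻¹ a) b ca)

      in-lists₁ : ∀ v → c₁ v ∈ L v
      in-lists₁ v with v ≟ᶠ x
      ... | yes refl = subst (_∈ L x) (≡-sym (updateAt-updates x c)) a∈Lx
      ... | no v≢x   = subst (_∈ L v) (≡-sym (updateAt-minimal v x c v≢x)) (in-lists v)

      one-neighbour : ∀ {u w} → T (((A′ ∪ B) ∩ c ⁻¹ a) u) → T (((A′ ∪ B) ∩ c ⁻¹ a) w) →
                      T (adj G x u) → T (adj G x w) → u ≡ w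
      one-neighbour tu tw xu xw = count≤1⇒≡ (A′ ∩ adj G x ∩ c ⁻¹ a) a-rare (nbr tu xu) (nbr tw xw)
        where
        nbr : ∀ {v} → T (((A′ ∪ B) ∩ c ⁻¹ a) v) → T (adj G x v) → T ((A′ ∩ adj G x ∩ c ⁻¹ a) v)
        nbr t xv with ∩⁻ (A′ ∪ B) (c ⁻¹ a) t
        ... | ab , ca with ∪⁻ A′ B ab
        ...   | inj₁ a′ = ∩⁺ (A′ ∩ adj G x) (c ⁻¹ a) (∩⁺ A′ (adj G x) a′ xv) ca
        ...   | inj₂ b  = contradiction b (a∉B ca)

      new-class : ∀ {v} → T (((A′ ∪ B₁) ∩ c₁ ⁻¹ a) v) → T (((A′ ∪ B) ∩ c ⁻¹ a) v) ⊎ v ≡ x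
      new-class t with ∩⁻ (A′ ∪ B₁) (c₁ ⁻¹ a) t
      ... | ab₁ , c₁a with recoloured c₁a
      ...   | inj₁ (v≡x , _)  = inj₂ v≡x
      ...   | inj₂ (v≢x , ca) = inj₁ (∩⁺ (A′ ∪ B) (c ⁻¹ a) (old-vertex v≢x ab₁) ca)

      other-class : ∀ {b} → a ≢ b → (A′ ∪ B₁) ∩ c₁ ⁻¹ b ⊆ (A′ ∪ B) ∩ c ⁻¹ b
      ⊆⇒ (other-class {b} a≢b) t with ∩⁻ (A′ ∪ B₁) (c₁ ⁻¹ b) t
      ... | ab₁ , c₁b with recoloured c₁b
      ...   | inj₁ (_ , a≡b)  = contradiction a≡b a≢b
      ...   | inj₂ (v≢x , cb) = ∩⁺ (A′ ∪ B) (c ⁻¹ b) (old-vertex v≢x ab₁) cb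

      forest₁ : ∀ b → Acyclic G ((A′ ∪ B₁) ∩ c₁ ⁻¹ b)
      forest₁ b with a ≟ b
      ... | yes refl = forest-insert G x (forest a) one-neighbour ∘ Cycle-map G (λ {v} → new-class {v})
      ... | no a≢b   = Acyclic-anti G (other-class a≢b) (forest b)

      A′-unchanged : ∀ b → A′ ∩ c₁ ⁻¹ b ⊆ A′ ∩ c ⁻¹ b
      ⊆⇒ (A′-unchanged b) t with ∩⁻ A′ (c₁ ⁻¹ b) t
      ... | a′ , c₁b with recoloured c₁b
      ...   | inj₁ (refl , _) = contradiction (∪⁺ˡ A′ B a′) x-new
      ...   | inj₂ (_ , cb)   = ∩⁺ A′ (c ⁻¹ b) a′ cb

      rainbow₁ : ∀ b → count (B₁ ∩ c₁ ⁻¹ b) ≤ 1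
      rainbow₁ b with a ≟ b
      ... | yes refl = count-⊆-singleton (B₁ ∩ c₁ ⁻¹ a) x only-x
        where
        only-x : B₁ ∩ c₁ ⁻¹ a ⊆ ⟦ [ x ] ⟧
        ⊆⇒ only-x t with ∩⁻ B₁ (c₁ ⁻¹ a) t
        ... | b₁ , c₁a with recoloured c₁a | ∪-singleton⁻ B b₁
        ...   | inj₁ (refl , _) | _        = ⟦⟧⁺ [ x ] (here refl)
        ...   | inj₂ (_ , ca)   | inj₁ bv  = contradiction bv (a∉B ca)
        ...   | inj₂ (v≢x , _)  | inj₂ v≡x = contradiction v≡x v≢x
      ... | no a≢b   = ≤-trans (count-mono old-B) (rainbow b)
        where
        old-B : B₁ ∩ c₁ ⁻¹ b ⊆ B ∩ c ⁻¹ b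
        ⊆⇒ old-B t with ∩⁻ B₁ (c₁ ⁻¹ b) t
        ... | b₁ , c₁b with recoloured c₁b | ∪-singleton⁻ B b₁
        ...   | inj₁ (_ , a≡b)  | _        = contradiction a≡b a≢b
        ...   | inj₂ (_ , cb)   | inj₁ bv  = ∩⁺ B (c ⁻¹ b) bv cb
        ...   | inj₂ (v≢x , _)  | inj₂ v≡x = contradiction v≡x v≢x

    colour-vertex : BlockColouring (B ∪ ⟦ [ x ] ⟧) (updateAt c x (const a))
    colour-vertex = record
      { in-lists = in-lists₁
      ; forest   = forest₁
      ; capacity = λ b → ≤-trans (count-mono (A′-unchanged b)) (capacity b)
      ; rainbow  = rainbow₁
      }

  extend-one : ∀ {B c} → BlockColouring B c → (x : Fin n) → ¬ T ((A′ ∪ B) x) →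
    count B + count B + degreeIn G A′ x < k + k → ∃ λ c₁ → BlockColouring (B ∪ ⟦ [ x ] ⟧) c₁
  extend-one {B} {c} bc x x∉ room =
    let a , a∈Lx , B-free , nbrs≤1 = free-colour B (A′ ∩ adj G x) c (L x) (proj₂ (L-ok x)) room′
    in updateAt c x (const a) , colour-vertex bc x x∉ a∈Lx B-free nbrs≤1
    where
    room′ : count B + count B + degreeIn G A′ x < length (L x) + length (L x)
    room′ = subst (λ l → count B + count B + degreeIn G A′ x < l + l) (≡-sym (proj₁ (L-ok x))) room

  extend : ∀ {B c} → BlockColouring B c → (xs : List (Fin n)) → Unique xs →
    All (λ x → ¬ T ((A′ ∪ B) x)) xs → Admissible G k A′ (count B) xs →
    ∃ λ c′ → BlockColouring (B ∪ ⟦ xs ⟧) c′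
  extend {B} {c} bc [] _ _ _ = c , BlockColouring-anti B∪∅⊆B bc
    where
    B∪∅⊆B : B ∪ ⟦ [] ⟧ ⊆ B
    ⊆⇒ B∪∅⊆B t with ∪⁻ B ⟦ [] ⟧ t
    ... | inj₁ b = b
    ... | inj₂ ()
  extend {B} bc (x ∷ xs) (x∉xs ∷ u) (x-new ∷ xs-new) (room , adm) =
    let c₁ , bc₁ = extend-one bc x x-new room
        c′ , bc′ = extend bc₁ xs u xs-new′ (subst (λ j → Admissible G k A′ j xs) (≡-sym count-B₁) adm)
    in c′ , BlockColouring-anti regroup bc′
    where
    B₁ = B ∪ ⟦ [ x ] ⟧
    count-B₁ : count B₁ ≡ suc (count B)
    count-B₁ = count-insert B x (x-new ∘ ∪⁺ʳ A′ B)
    xs-new′ : All (λ y → ¬ T ((A′ ∪ B₁) y)) xs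
    xs-new′ = All.zipWith (λ (x≢y , y-new) t → [ y-new , x≢y ∘ ≡-sym ]′ (∪-∪-singleton⁻ A′ B t))
                          (x∉xs , xs-new)
    regroup : B ∪ ⟦ x ∷ xs ⟧ ⊆ B₁ ∪ ⟦ xs ⟧
    ⊆⇒ regroup t with ∪⁻ B ⟦ x ∷ xs ⟧ t
    ... | inj₁ b = ∪⁺ˡ B₁ ⟦ xs ⟧ (∪⁺ˡ B ⟦ [ x ] ⟧ b)
    ... | inj₂ e with ⟦⟧⁻ (x ∷ xs) e
    ...   | here refl  = ∪⁺ˡ B₁ ⟦ xs ⟧ (∪⁺ʳ B ⟦ [ x ] ⟧ (⟦⟧⁺ [ x ] (here refl)))
    ...   | there v∈xs = ∪⁺ʳ B₁ ⟦ xs ⟧ (⟦⟧⁺ xs v∈xs)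

-- Building blocks

module _ (G : Graph n) {d : ℕ} (degenerate : Degenerate d G) where

  low-degree-vertex : (C : VSet n) → 0 < count C → ∃ λ x → T (C x) × degreeIn G C x ≤ d
  low-degree-vertex C C≢∅ =
    let x , cx , deg≤d = degenerate H (count>0⇒∃ C C≢∅)
    in x , cx , ≤-trans (≤-reflexive (same-degree x cx)) deg≤d
    where
    edge : Fin n → Fin n → Bool
    edge u v = C u ∧ C v ∧ adj G u v

    edge-sym : ∀ u v → edge u v ≡ edge v u
    edge-sym u v with C u | C v
    ... | true  | true  = Graph.sym G u v
    ... | true  | false = refl
    ... | false | true  = refl
    ... | false | false = refl

    edge-⊆ : ∀ u v → T (edge u v) → T (adj G u v)
    edge-⊆ u v t with C u | C v
    ... | true | true = t

    edge-S : ∀ u v → T (edge u v) → T (C u) × T (C v)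
    edge-S u v t with C u | C v
    ... | true | true = tt , tt

    H : Subgraph G
    H = record { S = C ; E = edge ; E-sym = edge-sym ; E-⊆ = edge-⊆ ; E-S = edge-S }

    same-neighbours : ∀ x → T (C x) → ∀ u → (C ∩ adj G x) u ≡ (C u ∧ᵇ edge x u)
    same-neighbours x cx u with C u | C x | cx
    ... | false | _    | _ = refl
    ... | true  | true | _ = refl

    same-degree : ∀ x → T (C x) → degreeIn G C x ≡ subDegree H x
    same-degree x cx =
      trans (count-≗ (same-neighbours x cx)) (≡-sym (countᵇ≡count (λ u → C u ∧ᵇ edge x u)))

  peel : (C : VSet n) (t : ℕ) → t ≤ count C →
    ∃ λ W → Unique W × All (T ∘ C) W × length W ≡ t × All (λ w → degreeIn G (C ∖ W) w ≤ d) W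
  peel C zero    _      = [] , [] , [] , refl , []
  peel C (suc t) t<C with low-degree-vertex C (≤-trans (s≤s z≤n) t<C)
  ... | w , cw , dw with peel (C ∖ [ w ]) t (≤-pred (≤-trans t<C (≤-reflexive (count-∖-one C w cw))))
  ... | W , uW , W⊆ , lenW , lowW =
    w ∷ W , All.map (λ t → w≢ (proj₂ (∖⁻ C [ w ] t))) W⊆ ∷ uW , cw ∷ All.map (proj₁ ∘ ∖⁻ C [ w ]) W⊆ ,
    cong suc lenW , ≤-trans (degreeIn-mono G (∖-⊆ C (w ∷ W)) w) dw ∷
    All.map (≤-trans (degreeIn-mono G (∖-++ C [ w ] W) _)) lowW
    where
    w≢ : ∀ {v} → v ∉ [ w ] → w ≢ v
    w≢ v∉ refl = v∉ (here refl)

claw-free⇒adjacent-pair : {G : Graph n} → ClawFree G → ∀ {x a b c} → a ≢ b → a ≢ c → b ≢ c →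
  T (adj G x a) → T (adj G x b) → T (adj G x c) →
  T (adj G a b) ⊎ T (adj G a c) ⊎ T (adj G b c)
claw-free⇒adjacent-pair {G = G} claw-free {x} {a} {b} {c} a≢b a≢c b≢c xa xb xc
  with adj G a b in ab | adj G a c in ac | adj G b c in bc
... | true  | _     | _     = inj₁ tt
... | false | true  | _     = inj₂ (inj₁ tt)
... | false | false | true  = inj₂ (inj₂ tt)
... | false | false | false = ⊥-elim (claw-free (x , a , b , c , a≢b , a≢c , b≢c , xa , xb , xc ,
                                    non-edge ab , non-edge ac , non-edge bc))
  where
  non-edge : ∀ {e} → e ≡ false → T (not e)
  non-edge refl = tt

module Blocks (G : Graph n) (k : ℕ) (degenerate : Degenerate 3 G) (claw-free : ClawFree G)
              (degree< : ∀ v → degree G v < k + k) (3≤k : 3 ≤ k) where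

  degreeIn< : ∀ D v → degreeIn G D v < k + k
  degreeIn< D v = ≤-trans (s≤s (count-mono (∩-⊆ʳ D (adj G v))))
                          (subst (_< k + k) (countᵇ≡count (adj G v)) (degree< v))

  record Block (A : VSet n) : Set where
    field
      vertices   : List (Fin n)
      unique     : Unique vertices
      ⊆A         : All (T ∘ A) vertices
      admissible : Admissible G k (A ∖ vertices) 0 vertices
  open Block public using (vertices)

  -- A block is laid out as prefix ++ (vertices peeled by degeneracy) ++ [ x ].
  record Prefix (A : VSet n) (x : Fin n) : Set where
    field
      prefix       : List (Fin n)
      unique       : Unique prefix
      ⊆A           : All (T ∘ A) prefix
      x∉           : x ∉ prefix
      short        : length prefix ≤ 2
      admissible   : Admissible G k (A ∖ (x ∷ prefix)) 0 prefix
      x-low-degree : degreeIn G (A ∖ prefix) x ≤ 1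

  small-block : (A : VSet n) → count A ≤ k → Σ (Block A) λ b → count (A ∖ vertices b) ≡ 0
  small-block A A≤k = block , A∖SS-empty
    where
    SS = elements A
    A∖SS-empty : count (A ∖ SS) ≡ 0
    A∖SS-empty = n≤0⇒n≡0 (≤-trans (count-mono A∖SS⊆∅) (≤-reflexive (count-∅ {n})))
      where
      A∖SS⊆∅ : A ∖ SS ⊆ ∅
      ⊆⇒ A∖SS⊆∅ t = let a , v∉SS = ∖⁻ A SS t in v∉SS (∈-elements A a)
    isolated : ∀ v → degreeIn G (A ∖ SS) v ≤ 0
    isolated v = ≤-trans (count-mono (∩-⊆ˡ (A ∖ SS) (adj G v))) (≤-reflexive A∖SS-empty)
    fits : length SS + length SS + 0 ≤ suc (k + k)
    fits = ≤-trans (≤-reflexive (+-identityʳ _)) (m≤n⇒m≤1+n (+-mono-≤ SS≤k SS≤k))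
      where
      SS≤k : length SS ≤ k
      SS≤k = ≤-trans (≤-reflexive (length-elements A)) A≤k
    block : Block A
    block = record
      { vertices = SS ; unique = elements-unique A ; ⊆A = elements-⊆ A
      ; admissible = Admissible-low-degree G k 0 SS (All.tabulate (λ {v} _ → isolated v)) fits }

  module _ {A : VSet n} {x : Fin n} (ax : T (A x)) (pf : Prefix A x) (W : List (Fin n)) (W-unique : Unique W)
           (W⊆C : All (T ∘ (A ∖ (x ∷ Prefix.prefix pf))) W)
           (W-low : All (λ w → degreeIn G (A ∖ (x ∷ Prefix.prefix pf) ∖ W) w ≤ 3) W)
           (k≡ : suc (length (Prefix.prefix pf) + length W) ≡ k) where

    private
      open Prefix pf renaming (prefix to pre; unique to pre-unique; ⊆A to pre⊆A; admissible to pre-admissible)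
      C  = A ∖ (x ∷ pre)
      SS = pre ++ W ++ [ x ]
      D  = A ∖ SS
      q  = length pre + length W

      W-new : ∀ {v} → v ∈ W → v ∉ x ∷ pre
      W-new v∈W = proj₂ (∖⁻ A (x ∷ pre) (All.lookup W⊆C v∈W))

      SS-unique : Unique SS
      SS-unique = ++⁺ pre-unique (++⁺ W-unique ([] ∷ []) W∩x) pre∩rest
        where
        W∩x : ∀ {v} → ¬ (v ∈ W × v ∈ [ x ])
        W∩x (v∈W , here refl) = W-new v∈W (here refl)
        pre∩rest : ∀ {v} → ¬ (v ∈ pre × v ∈ W ++ [ x ])
        pre∩rest (v∈pre , v∈rest) with ∈-++⁻ W v∈rest
        ... | inj₁ v∈W       = W-new v∈W (there v∈pre)
        ... | inj₂ (here refl) = x∉ v∈pre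

      length-SS : length SS ≡ k
      length-SS = begin
        length (pre ++ W ++ [ x ])     ≡⟨ length-++ pre ⟩
        length pre + length (W ++ [ x ]) ≡⟨ cong (length pre +_) (trans (length-++ W) (+-comm (length W) 1)) ⟩
        length pre + suc (length W)    ≡⟨ +-suc (length pre) (length W) ⟩
        suc q                          ≡⟨ k≡ ⟩
        k                              ∎
        where open ≡-Reasoning

      D⊆C : D ⊆ C
      D⊆C = ∖-anti A (x ∷ pre) SS λ { (here refl)    → ∈-++⁺ʳ pre (∈-++⁺ʳ W (here refl))
                                    ; (there v∈pre) → ∈-++⁺ˡ v∈pre }

      D⊆C∖W : D ⊆ C ∖ W
      D⊆C∖W = ⊆-trans (∖-anti A ((x ∷ pre) ++ W) SS x∷pre++W⊆SS) (∖-++ A (x ∷ pre) W)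
        where
        x∷pre++W⊆SS : ∀ {v} → v ∈ (x ∷ pre) ++ W → v ∈ SS
        x∷pre++W⊆SS (here refl)  = ∈-++⁺ʳ pre (∈-++⁺ʳ W (here refl))
        x∷pre++W⊆SS (there v∈)   with ∈-++⁻ pre v∈
        ... | inj₁ v∈pre = ∈-++⁺ˡ v∈pre
        ... | inj₂ v∈W   = ∈-++⁺ʳ pre (∈-++⁺ˡ v∈W)

      x-room : q + q + degreeIn G D x < k + k
      x-room = begin-strict
        q + q + degreeIn G D x ≤⟨ +-monoʳ-≤ (q + q) (≤-trans (degreeIn-mono G (∖-anti A pre SS ∈-++⁺ˡ) x)
                                                              x-low-degree) ⟩
        q + q + 1              <⟨ ≤-reflexive (1+[q+q+1]≡[1+q]+[1+q] q) ⟩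
        suc q + suc q          ≡⟨ cong₂ _+_ k≡ k≡ ⟩
        k + k                  ∎
        where
        open ≤-Reasoning
        1+[q+q+1]≡[1+q]+[1+q] : ∀ q → suc (q + q + 1) ≡ suc q + suc q
        1+[q+q+1]≡[1+q]+[1+q] = solve-∀

      W-fits : q + q + 3 ≤ suc (k + k)
      W-fits = subst (λ k′ → q + q + 3 ≤ suc (k′ + k′)) k≡ (≤-reflexive (q+q+3≡1+[1+q]+[1+q] q))
        where
        q+q+3≡1+[1+q]+[1+q] : ∀ q → q + q + 3 ≡ suc (suc q + suc q)
        q+q+3≡1+[1+q]+[1+q] = solve-∀

      SS-admissible : Admissible G k D 0 SS
      SS-admissible =
        Admissible-++ G k 0 pre (W ++ [ x ]) (Admissible-anti G k 0 pre D⊆C pre-admissible)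
          (Admissible-++ G k (length pre) W [ x ]
             (Admissible-anti G k (length pre) W D⊆C∖W (Admissible-low-degree G k (length pre) W W-low W-fits))
             (x-room , tt))

    assemble : Σ (Block A) λ b → length (vertices b) ≡ k
    assemble = record
      { vertices = SS ; unique = SS-unique
      ; ⊆A = ++⁺ᴬ pre⊆A (++⁺ᴬ (All.map (⊆⇒ (∖-⊆ A (x ∷ pre))) W⊆C) (ax ∷ []))
      ; admissible = SS-admissible } , length-SS

  block-from-prefix : ∀ {A x} → T (A x) → k < count A → Prefix A x →
                      Σ (Block A) λ b → length (vertices b) ≡ k
  block-from-prefix {A} {x} ax k<A pf =
    let W , W-unique , W⊆C , length-W , W-low = peel G degenerate C t t≤C
    in assemble ax pf W W-unique W⊆C W-low (trans (cong (λ l → suc (p + l)) length-W) p+t≡k)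
    where
    open Prefix pf
    p = length prefix
    C = A ∖ (x ∷ prefix)
    t = k ∸ suc p
    p+t≡k : suc p + t ≡ k
    p+t≡k = m+[n∸m]≡n (≤-trans (s≤s short) 3≤k)
    x∷prefix-unique : Unique (x ∷ prefix)
    x∷prefix-unique = All.tabulate (λ { v∈ refl → x∉ v∈ }) ∷ unique
    t≤C : t ≤ count C
    t≤C = +-cancelʳ-≤ (suc p) t (count C) (begin
      t + suc p       ≡⟨ +-comm t (suc p) ⟩
      suc p + t       ≡⟨ p+t≡k ⟩
      k               ≤⟨ n≤1+n k ⟩
      suc k           ≤⟨ k<A ⟩
      count A         ≡⟨ count-∖ A (x ∷ prefix) x∷prefix-unique (ax ∷ ⊆A) ⟩
      count C + suc p ∎)
      where open ≤-Reasoning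

  degreeIn-∖ : ∀ D x ys → Unique ys → All (T ∘ (D ∩ adj G x)) ys →
               length ys + degreeIn G (D ∖ ys) x ≤ degreeIn G D x
  degreeIn-∖ D x ys ys-unique ys⊆N = count-⊆-∖ (D ∩ adj G x) ((D ∖ ys) ∩ adj G x) ys ys-unique ys⊆N into
    where
    into : (D ∖ ys) ∩ adj G x ⊆ (D ∩ adj G x) ∖ ys
    ⊆⇒ into t = let d∖ys , xv = ∩⁻ (D ∖ ys) (adj G x) t ; d , v∉ys = ∖⁻ D ys d∖ys
                in ∖⁺ (D ∩ adj G x) ys (∩⁺ D (adj G x) d xv) v∉ys

  module _ {A : VSet n} {x : Fin n} (ax : T (A x)) where

    private
      N = A ∩ adj G x

      x-low : ∀ ys → Unique ys → All (T ∘ N) ys → degreeIn G A x ≤ length ys + 1 →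
              degreeIn G (A ∖ ys) x ≤ 1
      x-low ys ys-unique ys⊆N deg≤ =
        +-cancelˡ-≤ (length ys) _ 1 (≤-trans (degreeIn-∖ A x ys ys-unique ys⊆N) deg≤)

      x∉nbrs : ∀ {ys} → All (T ∘ N) ys → x ∉ ys
      x∉nbrs ys⊆N x∈ys = adj⇒≢ G (proj₂ (∩⁻ A (adj G x) (All.lookup ys⊆N x∈ys))) refl

    prefix-none : degreeIn G A x ≤ 1 → Prefix A x
    prefix-none deg≤1 = record
      { prefix = [] ; unique = [] ; ⊆A = [] ; x∉ = λ () ; short = z≤n ; admissible = tt
      ; x-low-degree = x-low [] [] [] deg≤1 }

    prefix-one : degreeIn G A x ≤ 2 → ∀ {y} → T (N y) → Prefix A x
    prefix-one deg≤2 {y} ny = record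
      { prefix = [ y ] ; unique = [] ∷ [] ; ⊆A = ay ∷ [] ; x∉ = x∉nbrs (ny ∷ []) ; short = s≤s z≤n
      ; admissible = degreeIn< _ y , tt ; x-low-degree = x-low [ y ] ([] ∷ []) (ny ∷ []) deg≤2 }
      where
      ay = proj₁ (∩⁻ A (adj G x) ny)

    prefix-two : degreeIn G A x ≤ 3 → ∀ {y z} → y ≢ z → T (N y) → T (N z) → T (adj G y z) → Prefix A x
    prefix-two deg≤3 {y} {z} y≢z ny nz yz = record
      { prefix = y ∷ z ∷ [] ; unique = yz-unique ; ⊆A = ay ∷ az ∷ [] ; x∉ = x∉nbrs (ny ∷ nz ∷ [])
      ; short = s≤s (s≤s z≤n) ; admissible = degreeIn< _ y , z-room , tt
      ; x-low-degree = x-low (y ∷ z ∷ []) yz-unique (ny ∷ nz ∷ []) deg≤3 }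
      where
      ay = proj₁ (∩⁻ A (adj G x) ny)
      az = proj₁ (∩⁻ A (adj G x) nz)
      yz-unique : Unique (y ∷ z ∷ [])
      yz-unique = (y≢z ∷ []) ∷ [] ∷ []
      x≢y : x ≢ y
      x≢y = adj⇒≢ G (proj₂ (∩⁻ A (adj G x) ny))
      -- x and y are neighbours of z inside the block, so they do not count against z.
      z-room : 1 + 1 + degreeIn G (A ∖ (x ∷ y ∷ z ∷ [])) z < k + k
      z-room = begin-strict
        2 + degreeIn G (A ∖ (x ∷ y ∷ z ∷ [])) z
          ≤⟨ +-monoʳ-≤ 2 (degreeIn-mono G (∖-anti A (x ∷ y ∷ []) (x ∷ y ∷ z ∷ []) xy⊆) z) ⟩
        2 + degreeIn G (A ∖ (x ∷ y ∷ [])) z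
          ≤⟨ degreeIn-∖ A z (x ∷ y ∷ []) ((x≢y ∷ []) ∷ [] ∷ [])
               (∩⁺ A (adj G z) ax (adj-sym G (proj₂ (∩⁻ A (adj G x) nz))) ∷
                ∩⁺ A (adj G z) ay (adj-sym G yz) ∷ []) ⟩
        degreeIn G A z
          <⟨ degreeIn< A z ⟩
        k + k ∎
        where
        open ≤-Reasoning
        xy⊆ : ∀ {v} → v ∈ x ∷ y ∷ [] → v ∈ x ∷ y ∷ z ∷ []
        xy⊆ (here refl)         = here refl
        xy⊆ (there (here refl)) = there (here refl)

    prefix-exists : degreeIn G A x ≤ 3 → Prefix A x
    prefix-exists deg≤3 with elements N | elements-unique N | elements-⊆ N | length-elements N
    ... | []                 | _ | _ | deg≡0 = prefix-none (≤-trans (≤-reflexive (≡-sym deg≡0)) z≤n)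
    ... | _ ∷ []             | _ | _ | deg≡1 = prefix-none (≤-reflexive (≡-sym deg≡1))
    ... | y ∷ _ ∷ []         | _ | ny ∷ _ | deg≡2 = prefix-one (≤-reflexive (≡-sym deg≡2)) ny
    ... | a ∷ b ∷ c ∷ []     | (a≢b ∷ a≢c ∷ []) ∷ (b≢c ∷ []) ∷ _ | na ∷ nb ∷ nc ∷ [] | _
      with claw-free⇒adjacent-pair {G = G} claw-free a≢b a≢c b≢c (nbr na) (nbr nb) (nbr nc)
      where
      nbr : ∀ {v} → T (N v) → T (adj G x v)
      nbr nv = proj₂ (∩⁻ A (adj G x) nv)
    ...   | inj₁ ab        = prefix-two deg≤3 a≢b na nb ab
    ...   | inj₂ (inj₁ ac) = prefix-two deg≤3 a≢c na nc ac
    ...   | inj₂ (inj₂ bc) = prefix-two deg≤3 b≢c nb nc bc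
    prefix-exists deg≤3 | _ ∷ _ ∷ _ ∷ _ ∷ _ | _ | _ | deg≡ =
      contradiction (≤-trans (≤-reflexive deg≡) deg≤3) λ { (s≤s (s≤s (s≤s ()))) }

  big-block : (A : VSet n) → k < count A → Σ (Block A) λ b → length (vertices b) ≡ k
  big-block A k<A =
    let x , ax , deg≤3 = low-degree-vertex G degenerate A (≤-trans (s≤s z≤n) k<A)
    in block-from-prefix ax k<A (prefix-exists ax deg≤3)

-- The induction

⌈0/k⌉≡0 : ∀ k .{{_ : NonZero k}} → ⌈ 0 / k ⌉ ≡ 0
⌈0/k⌉≡0 (suc k) = m<n⇒m/n≡0 (n<1+n k)

⌈m/k⌉>0 : ∀ {m} k .{{_ : NonZero k}} → 0 < m → 0 < ⌈ m / k ⌉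
⌈m/k⌉>0 {m} (suc k) m>0 = m≥n⇒m/n>0 (+-monoˡ-≤ k m>0)

⌈[m+k]/k⌉≡1+⌈m/k⌉ : ∀ m k .{{_ : NonZero k}} → ⌈ m + k / k ⌉ ≡ suc ⌈ m / k ⌉
⌈[m+k]/k⌉≡1+⌈m/k⌉ m k = begin
  (m + k + (k ∸ 1)) / k           ≡⟨ m/n≡1+[m∸n]/n (≤-trans (m≤n+m k m) (m≤m+n (m + k) (k ∸ 1))) ⟩
  suc ((m + k + (k ∸ 1) ∸ k) / k) ≡⟨ cong (λ i → suc ((i ∸ k) / k))
                                          (xy∙z≈xz∙y +-commutativeSemigroup m k (k ∸ 1)) ⟩
  suc ((m + (k ∸ 1) + k ∸ k) / k) ≡⟨ cong (λ i → suc (i / k)) (m+n∸n≡m (m + (k ∸ 1)) k) ⟩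
  suc ((m + (k ∸ 1)) / k)         ∎
  where open ≡-Reasoning

module Equitable (G : Graph n) (k : ℕ) .{{_ : NonZero k}}
                 (L : Fin n → List ℕ) (L-ok : ∀ v → length (L v) ≡ k × Unique (L v))
                 (degenerate : Degenerate 3 G) (claw-free : ClawFree G)
                 (degree< : ∀ v → degree G v < k + k) (3≤k : 3 ≤ k) where

  open Blocks G k degenerate claw-free degree< 3≤k

  record EquitableColouring (A : VSet n) (c : Fin n → ℕ) : Set where
    field
      in-lists  : ∀ v → c v ∈ L v
      forest    : ∀ a → Acyclic G (A ∩ c ⁻¹ a)
      equitable : ∀ a → count (A ∩ c ⁻¹ a) ≤ ⌈ count A / k ⌉

  colour-empty : (A : VSet n) → count A ≡ 0 → ∃ (EquitableColouring A)
  colour-empty A A≡0 = c , record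
    { in-lists  = λ v → proj₂ (some-colour v)
    ; forest    = λ { a (_ , f , _ , in-class , _) →
                      count≡0⇒∉ A A≡0 (f zero) (proj₁ (∩⁻ A (c ⁻¹ a) (in-class zero))) }
    ; equitable = λ a → ≤-trans (count-mono (∩-⊆ˡ A (c ⁻¹ a))) (≤-trans (≤-reflexive A≡0) z≤n)
    }
    where
    some-colour : ∀ v → ∃ (_∈ L v)
    some-colour v with L v | proj₁ (L-ok v)
    ... | a ∷ _ | _     = a , here refl
    ... | []    | 0≡k   = contradiction (≤-trans 3≤k (≤-reflexive (≡-sym 0≡k))) λ ()
    c : Fin n → ℕ
    c = proj₁ ∘ some-colour

  module _ (A : VSet n) (b : Block A) where

    private
      open Block b renaming (vertices to SS)
      A′ = A ∖ SS
      open Greedy G k L L-ok A′ ⌈ count A′ / k ⌉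

      SS-new : All (λ x → ¬ T ((A′ ∪ ∅) x)) SS
      SS-new = All.tabulate λ x∈SS t → proj₂ (∖⁻ A SS (⊆⇒ (∪-∅ A′) t)) x∈SS

      A-covered : A ⊆ A′ ∪ (∅ ∪ ⟦ SS ⟧)
      ⊆⇒ A-covered {v} a with T? (⟦ SS ⟧ v)
      ... | yes v∈SS = ∪⁺ʳ A′ (∅ ∪ ⟦ SS ⟧) (∪⁺ʳ ∅ ⟦ SS ⟧ v∈SS)
      ... | no v∉SS  = ∪⁺ˡ A′ (∅ ∪ ⟦ SS ⟧) (∖⁺ A SS a (v∉SS ∘ ⟦⟧⁺ SS))

      start : ∀ {c} → EquitableColouring A′ c → BlockColouring ∅ c
      start {c} ec = record
        { in-lists = in-lists
        ; forest   = λ a → Acyclic-anti G (∩-monoˡ (c ⁻¹ a) (∪-∅ A′)) (forest a)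
        ; capacity = equitable
        ; rainbow  = λ a → ≤-trans (count-mono (∩-⊆ˡ ∅ (c ⁻¹ a))) (≤-trans (≤-reflexive (count-∅ {n})) z≤n)
        }
        where open EquitableColouring ec

      finish : ∀ {c} → ⌈ count A′ / k ⌉ + 1 ≤ ⌈ count A / k ⌉ →
               BlockColouring (∅ ∪ ⟦ SS ⟧) c → EquitableColouring A c
      finish {c} ceiling bc = record
        { in-lists  = in-lists
        ; forest    = λ a → Acyclic-anti G (∩-monoˡ (c ⁻¹ a) A-covered) (forest a)
        ; equitable = λ a → begin
            count (A ∩ c ⁻¹ a)
              ≤⟨ count-mono (⊆-trans (∩-monoˡ (c ⁻¹ a) A-covered) (∩-distribʳ-∪ A′ (∅ ∪ ⟦ SS ⟧) (c ⁻¹ a))) ⟩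
            count (A′ ∩ c ⁻¹ a ∪ (∅ ∪ ⟦ SS ⟧) ∩ c ⁻¹ a)
              ≤⟨ count-∪ (A′ ∩ c ⁻¹ a) ((∅ ∪ ⟦ SS ⟧) ∩ c ⁻¹ a) ⟩
            count (A′ ∩ c ⁻¹ a) + count ((∅ ∪ ⟦ SS ⟧) ∩ c ⁻¹ a)
              ≤⟨ +-mono-≤ (capacity a) (rainbow a) ⟩
            ⌈ count A′ / k ⌉ + 1
              ≤⟨ ceiling ⟩
            ⌈ count A / k ⌉ ∎
        }
        where
        open BlockColouring bc
        open ≤-Reasoning

    colour-block : ⌈ count (A ∖ vertices b) / k ⌉ + 1 ≤ ⌈ count A / k ⌉ →
                   ∃ (EquitableColouring (A ∖ vertices b)) → ∃ (EquitableColouring A)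
    colour-block ceiling (c′ , ec′) =
      let c , bc = extend (start ec′) SS unique SS-new
                          (subst (λ j → Admissible G k A′ j SS) (≡-sym (count-∅ {n})) admissible)
      in c , finish ceiling bc

  Shrinks : (A : VSet n) → Block A → Set
  Shrinks A b = count (A ∖ vertices b) < count A × ⌈ count (A ∖ vertices b) / k ⌉ + 1 ≤ ⌈ count A / k ⌉

  full-block-shrinks : (A : VSet n) (b : Block A) → length (vertices b) ≡ k → Shrinks A b
  full-block-shrinks A b |b|≡k =
    subst (count A′ <_) (≡-sym A≡A′+k) (m<m+n (count A′) (≤-trans (s≤s z≤n) 3≤k)) ,
    ≤-reflexive (begin
      ⌈ count A′ / k ⌉ + 1     ≡⟨ +-comm _ 1 ⟩
      suc ⌈ count A′ / k ⌉     ≡⟨ ≡-sym (⌈[m+k]/k⌉≡1+⌈m/k⌉ (count A′) k) ⟩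
      ⌈ count A′ + k / k ⌉     ≡⟨ cong (λ m → ⌈ m / k ⌉) (≡-sym A≡A′+k) ⟩
      ⌈ count A / k ⌉          ∎)
    where
    open ≡-Reasoning
    A′ = A ∖ vertices b
    A≡A′+k : count A ≡ count A′ + k
    A≡A′+k = trans (count-∖ A (vertices b) (Block.unique b) (Block.⊆A b)) (cong (count A′ +_) |b|≡k)

  last-block-shrinks : (A : VSet n) (b : Block A) → 0 < count A → count (A ∖ vertices b) ≡ 0 → Shrinks A b
  last-block-shrinks A b A>0 A′≡0 rewrite A′≡0 =
    A>0 , subst (λ m → m + 1 ≤ ⌈ count A / k ⌉) (≡-sym (⌈0/k⌉≡0 k)) (⌈m/k⌉>0 k A>0)

  next-block : (A : VSet n) → 0 < count A → Σ (Block A) (Shrinks A)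
  next-block A A>0 with k <? count A
  ... | yes k<A = let b , |b|≡k = big-block A k<A in b , full-block-shrinks A b |b|≡k
  ... | no  k≮A = let b , A′≡0 = small-block A (≮⇒≥ k≮A) in b , last-block-shrinks A b A>0 A′≡0

  equitable-colouring : ∀ fuel (A : VSet n) → count A ≤ fuel → ∃ (EquitableColouring A)
  equitable-colouring zero       A A≤0 = colour-empty A (n≤0⇒n≡0 A≤0)
  equitable-colouring (suc fuel) A A≤ with count A ≟ 0
  ... | yes A≡0 = colour-empty A A≡0
  ... | no  A≢0 = let b , smaller , ceiling = next-block A (n≢0⇒n>0 A≢0)
                  in colour-block A b ceiling
                       (equitable-colouring fuel (A ∖ vertices b) (≤-pred (≤-trans smaller A≤)))

⌈m/2⌉≤k⇒m≤k+k : ∀ {m k} → ⌈ m /2⌉ ≤ k → m ≤ k + k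
⌈m/2⌉≤k⇒m≤k+k {m} {k} ⌈m/2⌉≤k = begin
  m                   ≡⟨ ≡-sym (⌊n/2⌋+⌈n/2⌉≡n m) ⟩
  ⌊ m /2⌋ + ⌈ m /2⌉   ≤⟨ +-mono-≤ (≤-trans (⌊n/2⌋≤⌈n/2⌉ m) ⌈m/2⌉≤k) ⌈m/2⌉≤k ⟩
  k + k               ∎
  where open ≤-Reasoning

5≤k+k⇒3≤k : ∀ {k} → 5 ≤ k + k → 3 ≤ k
5≤k+k⇒3≤k {suc (suc (suc k))} _ = s≤s (s≤s (s≤s z≤n))
5≤k+k⇒3≤k {suc (suc zero)} (s≤s (s≤s (s≤s (s≤s ()))))
5≤k+k⇒3≤k {suc zero} (s≤s (s≤s ()))
5≤k+k⇒3≤k {zero} ()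

corollary1 : {n : ℕ} (G : Graph n) (Δ : ℕ) → Degenerate 3 G → ClawFree G →
    MaxDegree G Δ → 4 ≤ Δ →
    (k : ℕ) .{{_ : NonZero k}} → ⌈ (Δ + 1) /2⌉ ≤ k →
    EquitableListPointArborable G k
corollary1 {n} G Δ degenerate claw-free (degree≤Δ , _) 4≤Δ k ⌈Δ+1/2⌉≤k (L , L-ok) =
  c , in-lists , (λ a → forest a ∘ Cycle-map G (λ {v} → ⁻¹⁺ c {a} {v})) , class-size
  where
  Δ<k+k : Δ < k + k
  Δ<k+k = subst (_≤ k + k) (+-comm Δ 1) (⌈m/2⌉≤k⇒m≤k+k ⌈Δ+1/2⌉≤k)
  open Equitable G k L L-ok degenerate claw-free (λ v → ≤-<-trans (degree≤Δ v) Δ<k+k)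
                 (5≤k+k⇒3≤k (≤-trans (s≤s 4≤Δ) Δ<k+k))
  colouring = equitable-colouring n (const true) (≤-reflexive count-full)
  c = proj₁ colouring
  open EquitableColouring (proj₂ colouring)
  class-size : ∀ a → countᵇ (c ⁻¹ a) ≤ ⌈ n / k ⌉
  class-size a =
    subst₂ (λ i m → i ≤ ⌈ m / k ⌉) (≡-sym (countᵇ≡count (c ⁻¹ a))) (count-full {n}) (equitable a)
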